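{- Consider an execution of the procedure \texttt{search}$(\mathcal{G},T)$ described below. Fix a pass of the inner while loop and a player $\alpha$, and let $Z$ (with strategy $\sigma$) be the first region computed in that pass whose priority $p$ satisfies $p\equiv\alpha\pmod 2$ (the highest region of player $\alpha$). Then every tangle $t$ returned by \texttt{extract-tangles}$(Z,\sigma)$ satisfies $E_T(t)=\emptyset$.
   Context: Parity games: $\mathcal{G}=(V_0,V_1,E,\mathsf{pr})$ with finite $V=V_0\cup V_1$ (Even owns $V_0$, Odd owns $V_1$), left-total $E\subseteq V\times V$, $\mathsf{pr}:V\to\{0,\dots,d\}$; plays are infinite paths, won by Even iff the highest priority seen infinitely often is even; $\overline{\alpha}$ is the opponent of $\alpha$; strategies are partial functions $\sigma\subseteq E$ on $V_\alpha$. A $p$-tangle is a nonempty $U\subseteq V$ with $p=\max\mathsf{pr}(U)$ and a witness strategy $\sigma_T(U):U\cap V_\alpha\to U$ of player $\alpha\equiv p\pmod 2$ such that $(U, E\cap(\sigma_T(U)\cup((U\cap V_{\overline\alpha})\times U)))$ is strongly connected and all its cycles have highest priority of parity $\alpha$. For a tangle $t$ of $\alpha$, $E_T(t)=\{v\in V\setminus t\mid \exists u\in t\cap V_{\overline\alpha}, (u,v)\in E\}$ (edges taken in the full game $\mathcal{G}$). For $U\subseteq V$, $\mathcal{G}\cap U$ is the subgame induced by $U$, and for a set of tangles $T$, $T\cap U=\{t\in T\mid t\subseteq U\}$. Tangle attractor: for a game $\mathcal{G}'$ with vertices $V'$, a set $T'$ of tangles and $A\subseteq V'$, $\mathit{TAttr}^{\mathcal{G}',T'}_\alpha(A)$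 is the least fixed point $Z$ of $Z=A\cup\{v\in V'_\alpha\mid E(v)\cap Z\ne\emptyset\}\cup\{v\in V'_{\overline\alpha}\mid E(v)\subseteq Z\}\cup\{v\in t\mid t\in T',\ \mathsf{pr}(t)\equiv\alpha \pmod 2,\ E_T(t)\neq\emptyset,\ E_T(t)\subseteq Z\}$ (with edges in $\mathcal{G}'$). It also yields a strategy $\sigma$ of $\alpha$: when an $\alpha$-vertex is added because of a successor in $Z$, $\sigma$ picks that successor; $\alpha$-vertices of $A$ get a successor in $Z$ when the backward search finds one; when the vertices of a tangle $t$ are added (tangles processed one at a time), $\sigma$ is extended by $\{(u,v)\in\sigma_T(t)\mid u\notin\mathrm{dom}(\sigma)\}$. \texttt{extract-tangles}$(Z,\sigma)$: compute the greatest $X\subseteq Z$ with $X=Z\cap(\{v\in V_{\overline\alpha}\mid E'(v)\subseteq X\}\cup\{v\in V_\alpha\mid\sigma(v)\in X\})$, where $E'$ are edges of the current subgame $\mathcal{G}'$; return the set of nontrivial bottom strongly connected components of the graph on $X$ whose edges are all $E'$-edges from $\overline\alpha$-vertices and the $\sigma$-edges from $\alpha$-vertices, each with witness strategy $\sigma$ restricted to it. \texttt{search}$(\mathcal{G},T)$: repeat forever: set the region function $\mathsf{r}:=\emptyset$ (a partial map $V\to\{0,\dots,d\}$) and $Y:=\emptyset$; while $V\setminus\mathrm{dom}(\mathsf{r})\ne\emptyset$: let $\mathcal{G}'=\mathcal{G}\cap(V\setminus\mathrm{dom}(\mathsf{r}))$, $T'=T\cap(V\setminus\mathrm{dom}(\mathsf{r}))$,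 $p$ the highest priority in $\mathcal{G}'$, $\alpha=p\bmod 2$; compute $(Z,\sigma)=\mathit{TAttr}^{\mathcal{G}',T'}_\alpha(\{v\in\mathcal{G}'\mid\mathsf{pr}(v)=p\})$ (the region of priority $p$); $A:=$\texttt{extract-tangles}$(Z,\sigma)$; if some $t\in A$ has $E_T(t)=\emptyset$, return $(T\cup Y,t)$; otherwise set $\mathsf{r}(v):=p$ for all $v\in Z$ and $Y:=Y\cup A$. After the while loop, set $T:=T\cup Y$. -}

module Defs where

open import Level using (0ℓ; Lift) renaming (suc to lsuc)
open import Data.Nat using (ℕ; zero; suc; _≤_; _⊔_)
open import Data.Fin using (Fin)
open import Data.Product using (Σ; ∃; ∃-syntax; _×_; _,_)
open import Data.Sum using (_⊎_)
open import Data.Empty using (⊥)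
open import Data.List using (List; []; _∷_)
open import Relation.Nullary using (¬_)
open import Relation.Unary using (Pred; _∈_; _∉_; _⊆_; _∪_; ∁; ｛_｝; ∅)
open import Relation.Binary using (Rel)
open import Relation.Binary.PropositionalEquality using (_≡_; _≢_)
open import Relation.Binary.Construct.Closure.ReflexiveTransitive using (Star)

data Player : Set where
  even odd : Player

opp : Player → Player
opp even = odd
opp odd  = even

-- parity p = the player α with p ≡ α (mod 2)
parity : ℕ → Player
parity zero    = even
parity (suc k) = opp (parity k)

-- Parity games  (V = Fin n, V₀ = owner⁻¹ even, V₁ = owner⁻¹ odd)

record Game : Set₁ where
  field
    n         : ℕ
    owner     : Fin n → Player
    E         : Rel (Fin n) 0ℓ
    leftTotal : ∀ u → ∃[ v ] E u v
    pr        : Fin n → ℕ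

-- A candidate tangle: a vertex set together with a (witness) strategy.
-- Strategies are partial functions σ ⊆ E, represented as relations
-- (σ u v  means  σ(u) = v).
record PreTangle (n : ℕ) : Set₁ where
  constructor pretangle
  field
    vs : Pred (Fin n) 0ℓ
    σT : Rel (Fin n) 0ℓ
open PreTangle public

module _ (G : Game) where
  open Game G

  VSet : Set₁
  VSet = Pred (Fin n) 0ℓ

  Strategy : Set₁
  Strategy = Rel (Fin n) 0ℓ

  TSet : Set₂
  TSet = Pred (PreTangle n) (lsuc 0ℓ)

  noTangles : TSet
  noTangles = λ _ → Lift (lsuc 0ℓ) ⊥

  IsTop : VSet → ℕ → Set
  IsTop U p = (∃[ v ] (v ∈ U × pr v ≡ p)) × (∀ v → v ∈ U → pr v ≤ p)

  data Walk (R : Rel (Fin n) 0ℓ) : Fin n → Fin n → ℕ → Set where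
    edge : ∀ {u v} → R u v → Walk R u v (pr u ⊔ pr v)
    step : ∀ {u w v m} → R u w → Walk R w v m → Walk R u v (pr u ⊔ m)
  -- a cycle through u with highest priority m is a  Walk R u u m

  TangleEdge : Player → VSet → Strategy → Rel (Fin n) 0ℓ
  TangleEdge α U σ u v = E u v × (σ u v ⊎ (u ∈ U × owner u ≡ opp α × v ∈ U))

  record IsTangle (U : VSet) (σ : Strategy) : Set where
    field
      p        : ℕ
      top      : IsTop U p
      σ-dom    : ∀ u v → σ u v → u ∈ U × owner u ≡ parity p × v ∈ U × E u v
      σ-total  : ∀ u → u ∈ U → owner u ≡ parity p → ∃[ v ] σ u v
      σ-fun    : ∀ u v w → σ u v → σ u w → v ≡ w
      strongly-connected :
        ∀ u v → u ∈ U → v ∈ U → Star (TangleEdge (parity p) U σ) u v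
      cycles   : ∀ u m → Walk (TangleEdge (parity p) U σ) u u m → parity m ≡ parity p

  ETin : VSet → Player → VSet → VSet
  ETin W α t v = v ∈ W × v ∉ t × ∃[ u ] (u ∈ t × owner u ≡ opp α × E u v)

  ET : Player → VSet → VSet
  ET α t v = v ∉ t × ∃[ u ] (u ∈ t × owner u ≡ opp α × E u v)

  update : Strategy → Fin n → Fin n → Strategy
  update σ v u w x = (w ≡ v × x ≡ u) ⊎ (w ≢ v × σ w x)

  extend : Strategy → Strategy → Strategy
  extend σ τ w x = σ w x ⊎ ((¬ (∃[ y ] σ w y)) × τ w x)

  restrict : Strategy → VSet → Strategy
  restrict σ t w x = w ∈ t × σ w x

  -- Tangle attractor TAttr^{𝒢',T'}_α(A) in the subgame with vertex set V'
  -- (T' is assumed to consist of (candidate) tangles contained in V').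

  module _ (V' : VSet) (T' : TSet) (α : Player) (A : VSet) where

    data AttrRun : VSet → Strategy → Set₂ where
      start  : AttrRun A (λ _ _ → ⊥)
      attr-own : ∀ {Z σ v u} → AttrRun Z σ →
        v ∈ V' → v ∉ Z → owner v ≡ α → E v u → u ∈ Z →
        AttrRun (Z ∪ ｛ v ｝) (update σ v u)
      attr-opp : ∀ {Z σ v} → AttrRun Z σ →
        v ∈ V' → v ∉ Z → owner v ≡ opp α → (∀ u → E v u → u ∈ V' → u ∈ Z) →
        AttrRun (Z ∪ ｛ v ｝) σ
      attr-tangle : ∀ {Z σ t p} → AttrRun Z σ →
        t ∈ T' → IsTop (vs t) p → parity p ≡ α →
        (∃[ v ] (v ∈ vs t × v ∉ Z)) →
        (∃[ v ] ETin V' α (vs t) v) → (∀ v → ETin V' α (vs t) v → v ∈ Z) →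
        AttrRun (Z ∪ vs t) (extend σ (σT t))
      -- backward search assigning a successor to an α-vertex of A
      assign : ∀ {Z σ a u} → AttrRun Z σ →
        a ∈ A → owner a ≡ α → ¬ (∃[ y ] σ a y) → E a u → u ∈ Z →
        AttrRun Z (update σ a u)

    Closed : VSet → Set₁
    Closed Z =
      (∀ v u → v ∈ V' → owner v ≡ α → E v u → u ∈ Z → v ∈ Z) ×
      (∀ v → v ∈ V' → owner v ≡ opp α → (∀ u → E v u → u ∈ V' → u ∈ Z) → v ∈ Z) ×
      (∀ t p → t ∈ T' → IsTop (vs t) p → parity p ≡ α →
         (∃[ v ] ETin V' α (vs t) v) → (∀ v → ETin V' α (vs t) v → v ∈ Z) → vs t ⊆ Z)

    record TAttr (Z : VSet) (σ : Strategy) : Set₂ where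
      field
        run      : AttrRun Z σ
        closed   : Closed Z
        A-strat  : ∀ a u → a ∈ A → owner a ≡ α → E a u → u ∈ Z → ∃[ y ] σ a y

  module _ (V' : VSet) (α : Player) (Z : VSet) (σ : Strategy) where

    XBody : VSet → VSet
    XBody X v = v ∈ Z ×
      ((owner v ≡ opp α × (∀ u → E v u → u ∈ V' → u ∈ X)) ⊎
       (owner v ≡ α × ∃[ u ] (σ v u × u ∈ X)))

    IsFixX : VSet → Set
    IsFixX X = ∀ v → (v ∈ X → v ∈ XBody X) × (v ∈ XBody X → v ∈ X)

    IsGreatestX : VSet → Set₁
    IsGreatestX X = IsFixX X × (∀ X' → IsFixX X' → X' ⊆ X)

    XEdge : VSet → Rel (Fin n) 0ℓ
    XEdge X u v = u ∈ X × v ∈ X ×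
      ((owner u ≡ opp α × E u v × v ∈ V') ⊎ (owner u ≡ α × σ u v))

    IsNontrivialBSCC : VSet → VSet → Set
    IsNontrivialBSCC X C =
      (∀ u → u ∈ C → u ∈ X) ×
      (∃[ u ] (u ∈ C)) ×
      (∀ u v → u ∈ C → v ∈ C → Star (XEdge X) u v) ×
      (∀ u w → u ∈ C → Star (XEdge X) u w → Star (XEdge X) w u → w ∈ C) ×
      (∀ u v → u ∈ C → XEdge X u v → v ∈ C) ×
      (∃[ u ] ∃[ v ] (u ∈ C × v ∈ C × XEdge X u v))

    -- t is one of the tangles returned by extract-tangles(Z , σ)
    Extracted : TSet
    Extracted t = ∃[ X ] (IsGreatestX X × IsNontrivialBSCC X (vs t) × σT t ≡ restrict σ (vs t))

  -- One iteration of the inner while loop of search, with current tangle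
  -- set T and dom(r) = D: the computed region has priority p and is (Z , σ).

  subT : TSet → VSet → TSet
  subT T W t = t ∈ T × vs t ⊆ W

  Region : TSet → VSet → ℕ → VSet → Strategy → Set₂
  Region T D p Z σ =
    IsTop (∁ D) p ×
    TAttr (∁ D) (subT T (∁ D)) (parity p) (λ v → v ∈ ∁ D × pr v ≡ p) Z σ

  -- PassReaches T D Y ps : within one pass (one run of the while loop) with
  -- tangle set T, the state dom(r) = D, Y is reached without returning,
  -- ps = priorities of the regions computed so far (in order).
  data PassReaches (T : TSet) : VSet → TSet → List ℕ → Set₃ where
    start : PassReaches T ∅ noTangles []
    next  : ∀ {D Y ps p Z σ} → PassReaches T D Y ps →
      Region T D p Z σ →
      (∀ t → t ∈ Extracted (∁ D) (parity p) Z σ → ∃[ v ] ET (parity p) (vs t) v) →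
      PassReaches T (D ∪ Z) (Y ∪ Extracted (∁ D) (parity p) Z σ) (ps Data.List.∷ʳ p)

  -- OuterReaches T₀ T : T is the tangle set at the start of some pass of
  -- search(𝒢 , T₀)
  data OuterReaches (T₀ : TSet) : TSet → Set₃ where
    init : OuterReaches T₀ T₀
    pass : ∀ {T D Y ps} → OuterReaches T₀ T → PassReaches T D Y ps →
      (∀ v → v ∈ D) → OuterReaches T₀ (T ∪ Y)

module Submission where

open import Defs
open import Data.Product using (_,_; proj₁; proj₂)
open import Data.Sum using (inj₁; inj₂)
open import Data.Empty using (⊥-elim)
open import Function using (_∘_)
open import Data.List.Relation.Unary.All using (All)
open import Data.List.Relation.Unary.All.Properties using (∷ʳ⁻)
open import Relation.Nullary using (¬_)
open import Relation.Unary using (_∈_; ∁; _⊆_)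
open import Relation.Binary.PropositionalEquality using (_≡_; _≢_; refl; sym; trans)

-- An α-tangle t extracted from the region Z can only escape through an edge of an
-- ᾱ-vertex. Inside the current subgame such an edge stays in the greatest fixed point
-- X and hence, t being a bottom SCC, in t. Outside it the edge would lead into an
-- earlier region; all of those belong to ᾱ, whose attractors would have absorbed the
-- ᾱ-vertex.

opp≢ : ∀ α → opp α ≢ α
opp≢ even ()
opp≢ odd  ()

≢⇒≡opp : ∀ α β → β ≢ α → β ≡ opp α
≢⇒≡opp even even β≢α = ⊥-elim (β≢α refl)
≢⇒≡opp even odd  _   = refl
≢⇒≡opp odd  even _   = refl
≢⇒≡opp odd  odd  β≢α = ⊥-elim (β≢α refl)

module _ (G : Game) where
  open Game G

  OppClosed : Player → VSet G → Set
  OppClosed α W = ∀ {u v} → u ∈ W → owner u ≡ opp α → E u v → v ∈ W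

  AttrRun⊆ : ∀ {V' T' α A Z σ} → (∀ t → t ∈ T' → vs t ⊆ V') → A ⊆ V' →
    AttrRun G V' T' α A Z σ → Z ⊆ V'
  AttrRun⊆ T'⊆ A⊆ start                                 = A⊆
  AttrRun⊆ T'⊆ A⊆ (attr-own r _ _ _ _ _)    (inj₁ z)    = AttrRun⊆ T'⊆ A⊆ r z
  AttrRun⊆ T'⊆ A⊆ (attr-own r v∈V' _ _ _ _) (inj₂ refl) = v∈V'
  AttrRun⊆ T'⊆ A⊆ (attr-opp r _ _ _ _)      (inj₁ z)    = AttrRun⊆ T'⊆ A⊆ r z
  AttrRun⊆ T'⊆ A⊆ (attr-opp r v∈V' _ _ _)   (inj₂ refl) = v∈V'
  AttrRun⊆ T'⊆ A⊆ (attr-tangle r _ _ _ _ _ _) (inj₁ z)  = AttrRun⊆ T'⊆ A⊆ r z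
  AttrRun⊆ T'⊆ A⊆ (attr-tangle {t = t} r t∈T' _ _ _ _ _) (inj₂ z) = T'⊆ t t∈T' z
  AttrRun⊆ T'⊆ A⊆ (assign r _ _ _ _ _)                  = AttrRun⊆ T'⊆ A⊆ r

  Region⊆∁ : ∀ {T D p Z σ} → Region G T D p Z σ → Z ⊆ ∁ D
  Region⊆∁ {D = D} (_ , attr) =
    AttrRun⊆ {V' = ∁ D} (λ _ t∈T' → proj₂ {B = λ _ → _ ⊆ ∁ D} t∈T') proj₁ (TAttr.run attr)

  PassReaches-OppClosed : ∀ {T D Y ps} α → PassReaches G T D Y ps →
    All (λ q → parity q ≢ α) ps → OppClosed α (∁ D)
  PassReaches-OppClosed α start _ _ _ _ ()
  PassReaches-OppClosed α (next earlier _ _) ps≢α u∉D∪Z ᾱu e (inj₁ v∈D) =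
    PassReaches-OppClosed α earlier (proj₁ (∷ʳ⁻ ps≢α)) (u∉D∪Z ∘ inj₁) ᾱu e v∈D
  PassReaches-OppClosed α (next {p = p} _ (_ , attr) _) ps≢α u∉D∪Z ᾱu e (inj₂ v∈Z) =
    u∉D∪Z (inj₂ (proj₁ (TAttr.closed attr) _ _ (u∉D∪Z ∘ inj₁) ᾱu′ e v∈Z))
    where
    ᾱu′ : owner _ ≡ parity p
    ᾱu′ = trans ᾱu (sym (≢⇒≡opp α (parity p) (proj₂ (∷ʳ⁻ ps≢α))))

  module _ {V' α Z σ t} (t∈A : t ∈ Extracted G V' α Z σ) where
    private
      X = proj₁ t∈A
      X-fix = proj₁ (proj₁ (proj₂ t∈A))
      t-bscc = proj₁ (proj₂ (proj₂ t∈A))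
      t⊆X = proj₁ t-bscc
      t-bottom = proj₁ (proj₂ (proj₂ (proj₂ (proj₂ t-bscc))))

    Extracted⊆ : vs t ⊆ Z
    Extracted⊆ u∈t = proj₁ (proj₁ (X-fix _) (t⊆X _ u∈t))

    Extracted-OppClosed-in : ∀ {u v} → u ∈ vs t → owner u ≡ opp α → E u v → v ∈ V' → v ∈ vs t
    Extracted-OppClosed-in {u} {v} u∈t ᾱu e v∈V' =
      t-bottom u v u∈t (u∈X , v∈X , inj₁ (ᾱu , e , v∈V'))
      where
      u∈X = t⊆X u u∈t
      v∈X : v ∈ X
      v∈X with proj₂ (proj₁ (X-fix u) u∈X)
      ... | inj₁ (_ , succ⊆X) = succ⊆X v e v∈V'
      ... | inj₂ (αu , _)     = ⊥-elim (opp≢ α (trans (sym ᾱu) αu))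

lemma8 : (G : Game) (T₀ : TSet G) →
    (∀ t → t ∈ T₀ → IsTangle G (vs t) (σT t)) →
    ∀ {T} → OuterReaches G T₀ T →
    ∀ {D Y ps} → PassReaches G T D Y ps →
    (α : Player) → ∀ {p Z σ} → Region G T D p Z σ →
    parity p ≡ α → All (λ q → parity q ≢ α) ps →
    ∀ t → t ∈ Extracted G (∁ D) α Z σ → ∀ v → ¬ (v ∈ ET G α (vs t))
lemma8 G _ _ _ {D = D} run α region _ ps≢α t t∈A v (v∉t , u , u∈t , ᾱu , e) =
  v∉t (Extracted-OppClosed-in G t∈A u∈t ᾱu e v∈∁D)
  where
  u∈∁D : u ∈ ∁ D
  u∈∁D = Region⊆∁ G region (Extracted⊆ G t∈A u∈t)
  v∈∁D : v ∈ ∁ D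
  v∈∁D = PassReaches-OppClosed G α run ps≢α u∈∁D ᾱu e
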